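{- Let $\mathcal{L}$ be a first-order signature. Each elimination rule of $\mathcal{ST}^H$ is derivable in $\mathcal{ST}^{HC}$: for every instance of such a rule, its conclusion is derivable in $\mathcal{ST}^{HC}$ from its premise.
   Context: Signature $\mathcal{L}$: relation and function symbols of finite arity, at least one relation symbol; formulas built with $\neg,\wedge,\vee,\forall,\exists$; $\varphi[x\mapsto t]$ is capture-free substitution. The Henkin expansion $\mathrm{Hen}\,\mathcal{L}=\bigcup_i\mathcal{L}_i$, where $\mathcal{L}_0=\mathcal{L}$ and $\mathcal{L}_{i+1}$ adds to $\mathcal{L}_i$ a new constant $\mathsf{w}(\forall x\,\varphi)$ for each universal $\mathcal{L}_i$-formula $\forall x\,\varphi$ and $\mathsf{w}(\exists x\,\varphi)$ for each existential $\mathcal{L}_i$-formula $\exists x\,\varphi$; its formulas/terms are $\mathcal{L}$-Henkin formulas/terms. An $\mathcal{L}$-Henkin sequent $\Gamma\vartriangleright\Delta$ is a pair of finite sets of $\mathcal{L}$-Henkin formulas; $\varphi,\Gamma$ means $\{\varphi\}\cup\Gamma$. The calculus $\mathcal{ST}^H$ ($t$ ranges over $\mathcal{L}$-Henkin terms): axiom (ID) $\varphi\vartriangleright\varphi$; (WL), (WR) weakening on either side; bidirectional rules, premises / conclusion: ($\wedge$L) $\varphi,\psi,\Gamma\vartriangleright\Delta$ / $\varphi\wedge\psi,\Gamma\vartriangleright\Delta$; ($\wedge$R) $\Gamma\vartriangleright\Delta,\varphi$ and $\Gamma\vartriangleright\Delta,\psi$ / $\Gamma\vartriangleright\Delta,\varphi\wedge\psi$;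 ($\vee$L) $\varphi,\Gamma\vartriangleright\Delta$ and $\psi,\Gamma\vartriangleright\Delta$ / $\varphi\vee\psi,\Gamma\vartriangleright\Delta$; ($\vee$R) $\Gamma\vartriangleright\Delta,\varphi,\psi$ / $\Gamma\vartriangleright\Delta,\varphi\vee\psi$; ($\neg$R) $\varphi,\Gamma\vartriangleright\Delta$ / $\Gamma\vartriangleright\Delta,\neg\varphi$; ($\neg$L) $\Gamma\vartriangleright\Delta,\varphi$ / $\neg\varphi,\Gamma\vartriangleright\Delta$; ($\forall$LW) $\varphi[x\mapsto\mathsf{w}(\forall x\,\varphi)],\Gamma\vartriangleright\Delta$ / $\forall x\,\varphi,\Gamma\vartriangleright\Delta$; ($\forall$RW) $\Gamma\vartriangleright\Delta,\varphi[x\mapsto\mathsf{w}(\forall x\,\varphi)]$ / $\Gamma\vartriangleright\Delta,\forall x\,\varphi$; ($\exists$LW), ($\exists$RW) analogously with $\mathsf{w}(\exists x\,\varphi)$, $\exists x\,\varphi$. Their top-down use (premises to conclusion) is an introduction rule; their bottom-up use (from the conclusion to any one of the premises) is an elimination rule. One-directional rules: introduction rules (UWI) $\varphi[x\mapsto t],\Gamma\vartriangleright\Delta$ / $\varphi[x\mapsto\mathsf{w}(\forall x\,\varphi)],\Gamma\vartriangleright\Delta$ and (EWI) $\Gamma\vartriangleright\Delta,\varphi[x\mapsto t]$ / $\Gamma\vartriangleright\Delta,\varphi[x\mapsto\mathsf{w}(\exists x\,\varphi)]$; elimination rules (EWE) $\varphi[x\mapsto\mathsf{w}(\exists x\,\varphi)],\Gamma\vartriangleright\Delta$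 / $\varphi[x\mapsto t],\Gamma\vartriangleright\Delta$ and (UWE) $\Gamma\vartriangleright\Delta,\varphi[x\mapsto\mathsf{w}(\forall x\,\varphi)]$ / $\Gamma\vartriangleright\Delta,\varphi[x\mapsto t]$. So the elimination rules of $\mathcal{ST}^H$ are the bottom-up directions of the bidirectional rules together with (EWE) and (UWE). The calculus $\mathcal{ST}^{HC}$ is obtained from $\mathcal{ST}^H$ by removing all elimination rules, adding (CUT): from $\Gamma\vartriangleright\Delta,\varphi$ and $\varphi,\Pi\vartriangleright\Sigma$ infer $\Gamma\cup\Pi\vartriangleright\Delta\cup\Sigma$, and adding the bidirectional rules (WEXCHL): $\varphi[x\mapsto\mathsf{w}(\forall x\,\psi)],\Gamma\vartriangleright\Delta$ / $\varphi[x\mapsto\mathsf{w}(\exists x\,\neg\psi)],\Gamma\vartriangleright\Delta$ and (WEXCHR): $\Gamma\vartriangleright\Delta,\varphi[x\mapsto\mathsf{w}(\forall x\,\psi)]$ / $\Gamma\vartriangleright\Delta,\varphi[x\mapsto\mathsf{w}(\exists x\,\neg\psi)]$ (each usable in both directions). Derivability $X\vdash S$ in a calculus means a finite derivation of $S$ whose leaves are (ID) instances or members of $X$. -}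

module Defs where

open import Data.Nat using (ℕ; zero; suc; _<ᵇ_; _≡ᵇ_; pred)
open import Data.Bool using (if_then_else_)
open import Data.Vec using (Vec; []; _∷_)
open import Data.List using (List; []; _∷_; _++_)
open import Data.List.Membership.Propositional using (_∈_)
open import Data.Product using (_×_; _,_)

record Signature : Set₁ where
  field
    Rel      : Set
    relArity : Rel → ℕ
    Fun      : Set
    funArity : Fun → ℕ
    someRel  : Rel

module Henkin (L : Signature) where
  open Signature L

  -- L-Henkin terms and formulas (the union of all levels L_i of Hen L).
  -- Variables are de Bruijn indices.  `wAll φ` is the witness constant
  -- w(∀x φ) and `wEx φ` is w(∃x φ), where φ is the body of the quantifier
  -- (index 0 is the bound variable x).  Witnesses are constants: they are
  -- atomic, substitution and shifting do not enter them.
  mutual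
    data Term : Set where
      var  : ℕ → Term
      app  : (f : Fun) → Vec Term (funArity f) → Term
      wAll : Formula → Term
      wEx  : Formula → Term

    data Formula : Set where
      rel : (r : Rel) → Vec Term (relArity r) → Formula
      Not : Formula → Formula
      And : Formula → Formula → Formula
      Or  : Formula → Formula → Formula
      All : Formula → Formula
      Ex  : Formula → Formula

  mutual
    shiftT : ℕ → Term → Term
    shiftT c (var i)    = var (if i <ᵇ c then i else suc i)
    shiftT c (app f ts) = app f (shiftTs c ts)
    shiftT c (wAll φ)   = wAll φ
    shiftT c (wEx φ)    = wEx φ

    shiftTs : ∀ {n} → ℕ → Vec Term n → Vec Term n
    shiftTs c []       = []
    shiftTs c (t ∷ ts) = shiftT c t ∷ shiftTs c ts

  mutual
    substT : ℕ → Term → Term → Term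
    substT k s (var i)    = if i ≡ᵇ k then s else (if i <ᵇ k then var i else var (pred i))
    substT k s (app f ts) = app f (substTs k s ts)
    substT k s (wAll φ)   = wAll φ
    substT k s (wEx φ)    = wEx φ

    substTs : ∀ {n} → ℕ → Term → Vec Term n → Vec Term n
    substTs k s []       = []
    substTs k s (t ∷ ts) = substT k s t ∷ substTs k s ts

  substF : ℕ → Term → Formula → Formula
  substF k s (rel r ts) = rel r (substTs k s ts)
  substF k s (Not φ)    = Not (substF k s φ)
  substF k s (And φ ψ)  = And (substF k s φ) (substF k s ψ)
  substF k s (Or φ ψ)   = Or (substF k s φ) (substF k s ψ)
  substF k s (All φ)    = All (substF (suc k) (shiftT 0 s) φ)
  substF k s (Ex φ)     = Ex (substF (suc k) (shiftT 0 s) φ)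

  _[_] : Formula → Term → Formula
  φ [ t ] = substF 0 t φ

  -- Sequents: pairs of finite sets, represented by lists; two lists
  -- represent the same set iff they have the same members.  φ,Γ is φ ∷ Γ
  -- and Γ ∪ Π is Γ ++ Π.
  Sequent : Set
  Sequent = List Formula × List Formula

  _≋_ : List Formula → List Formula → Set
  Γ ≋ Γ' = ∀ φ → (φ ∈ Γ → φ ∈ Γ') × (φ ∈ Γ' → φ ∈ Γ)

  infix 4 _⊢HC_
  data _⊢HC_ (X : Sequent → Set) : Sequent → Set where
    -- sequents are sets: derivability only depends on the represented sets
    setEq : ∀ {Γ Γ' Δ Δ'} → Γ ≋ Γ' → Δ ≋ Δ' → X ⊢HC (Γ , Δ) → X ⊢HC (Γ' , Δ')
    hyp   : ∀ {S} → X S → X ⊢HC S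
    ID    : ∀ {φ} → X ⊢HC (φ ∷ [] , φ ∷ [])
    WL    : ∀ {φ Γ Δ} → X ⊢HC (Γ , Δ) → X ⊢HC (φ ∷ Γ , Δ)
    WR    : ∀ {φ Γ Δ} → X ⊢HC (Γ , Δ) → X ⊢HC (Γ , φ ∷ Δ)
    ∧L    : ∀ {φ ψ Γ Δ} → X ⊢HC (φ ∷ ψ ∷ Γ , Δ) → X ⊢HC (And φ ψ ∷ Γ , Δ)
    ∧R    : ∀ {φ ψ Γ Δ} → X ⊢HC (Γ , φ ∷ Δ) → X ⊢HC (Γ , ψ ∷ Δ) → X ⊢HC (Γ , And φ ψ ∷ Δ)
    ∨L    : ∀ {φ ψ Γ Δ} → X ⊢HC (φ ∷ Γ , Δ) → X ⊢HC (ψ ∷ Γ , Δ) → X ⊢HC (Or φ ψ ∷ Γ , Δ)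
    ∨R    : ∀ {φ ψ Γ Δ} → X ⊢HC (Γ , φ ∷ ψ ∷ Δ) → X ⊢HC (Γ , Or φ ψ ∷ Δ)
    ¬R    : ∀ {φ Γ Δ} → X ⊢HC (φ ∷ Γ , Δ) → X ⊢HC (Γ , Not φ ∷ Δ)
    ¬L    : ∀ {φ Γ Δ} → X ⊢HC (Γ , φ ∷ Δ) → X ⊢HC (Not φ ∷ Γ , Δ)
    ∀LW   : ∀ {φ Γ Δ} → X ⊢HC (φ [ wAll φ ] ∷ Γ , Δ) → X ⊢HC (All φ ∷ Γ , Δ)
    ∀RW   : ∀ {φ Γ Δ} → X ⊢HC (Γ , φ [ wAll φ ] ∷ Δ) → X ⊢HC (Γ , All φ ∷ Δ)
    ∃LW   : ∀ {φ Γ Δ} → X ⊢HC (φ [ wEx φ ] ∷ Γ , Δ) → X ⊢HC (Ex φ ∷ Γ , Δ)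
    ∃RW   : ∀ {φ Γ Δ} → X ⊢HC (Γ , φ [ wEx φ ] ∷ Δ) → X ⊢HC (Γ , Ex φ ∷ Δ)
    UWI   : ∀ {φ Γ Δ} (t : Term) → X ⊢HC (φ [ t ] ∷ Γ , Δ) → X ⊢HC (φ [ wAll φ ] ∷ Γ , Δ)
    EWI   : ∀ {φ Γ Δ} (t : Term) → X ⊢HC (Γ , φ [ t ] ∷ Δ) → X ⊢HC (Γ , φ [ wEx φ ] ∷ Δ)
    CUT   : ∀ {φ Γ Δ Π Σ} → X ⊢HC (Γ , φ ∷ Δ) → X ⊢HC (φ ∷ Π , Σ) → X ⊢HC (Γ ++ Π , Δ ++ Σ)
    WEXCHL↓ : ∀ {φ ψ Γ Δ} → X ⊢HC (φ [ wAll ψ ] ∷ Γ , Δ) → X ⊢HC (φ [ wEx (Not ψ) ] ∷ Γ , Δ)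
    WEXCHL↑ : ∀ {φ ψ Γ Δ} → X ⊢HC (φ [ wEx (Not ψ) ] ∷ Γ , Δ) → X ⊢HC (φ [ wAll ψ ] ∷ Γ , Δ)
    WEXCHR↓ : ∀ {φ ψ Γ Δ} → X ⊢HC (Γ , φ [ wAll ψ ] ∷ Δ) → X ⊢HC (Γ , φ [ wEx (Not ψ) ] ∷ Δ)
    WEXCHR↑ : ∀ {φ ψ Γ Δ} → X ⊢HC (Γ , φ [ wEx (Not ψ) ] ∷ Δ) → X ⊢HC (Γ , φ [ wAll ψ ] ∷ Δ)

  -- Elim P C : an instance of an elimination rule of ST^H with premise P
  -- and conclusion C (bottom-up directions of the bidirectional rules,
  -- to any one premise, plus (EWE) and (UWE)).
  data Elim : Sequent → Sequent → Set where
    ∧L-e  : ∀ {φ ψ Γ Δ} → Elim (And φ ψ ∷ Γ , Δ) (φ ∷ ψ ∷ Γ , Δ)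
    ∧R-e₁ : ∀ {φ ψ Γ Δ} → Elim (Γ , And φ ψ ∷ Δ) (Γ , φ ∷ Δ)
    ∧R-e₂ : ∀ {φ ψ Γ Δ} → Elim (Γ , And φ ψ ∷ Δ) (Γ , ψ ∷ Δ)
    ∨L-e₁ : ∀ {φ ψ Γ Δ} → Elim (Or φ ψ ∷ Γ , Δ) (φ ∷ Γ , Δ)
    ∨L-e₂ : ∀ {φ ψ Γ Δ} → Elim (Or φ ψ ∷ Γ , Δ) (ψ ∷ Γ , Δ)
    ∨R-e  : ∀ {φ ψ Γ Δ} → Elim (Γ , Or φ ψ ∷ Δ) (Γ , φ ∷ ψ ∷ Δ)
    ¬R-e  : ∀ {φ Γ Δ} → Elim (Γ , Not φ ∷ Δ) (φ ∷ Γ , Δ)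
    ¬L-e  : ∀ {φ Γ Δ} → Elim (Not φ ∷ Γ , Δ) (Γ , φ ∷ Δ)
    ∀LW-e : ∀ {φ Γ Δ} → Elim (All φ ∷ Γ , Δ) (φ [ wAll φ ] ∷ Γ , Δ)
    ∀RW-e : ∀ {φ Γ Δ} → Elim (Γ , All φ ∷ Δ) (Γ , φ [ wAll φ ] ∷ Δ)
    ∃LW-e : ∀ {φ Γ Δ} → Elim (Ex φ ∷ Γ , Δ) (φ [ wEx φ ] ∷ Γ , Δ)
    ∃RW-e : ∀ {φ Γ Δ} → Elim (Γ , Ex φ ∷ Δ) (Γ , φ [ wEx φ ] ∷ Δ)
    EWE   : ∀ {φ Γ Δ} (t : Term) → Elim (φ [ wEx φ ] ∷ Γ , Δ) (φ [ t ] ∷ Γ , Δ)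
    UWE   : ∀ {φ Γ Δ} (t : Term) → Elim (Γ , φ [ wAll φ ] ∷ Δ) (Γ , φ [ t ] ∷ Δ)

-- Every elimination rule is a cut of its premise against a sequent that the
-- corresponding introduction rule derives from identity axioms: e.g. the
-- premise Γ ▷ Δ, φ ∧ ψ cut against φ ∧ ψ ▷ φ gives Γ ▷ Δ, φ, and the premise
-- φ[w(∃x φ)], Γ ▷ Δ cut against φ[t] ▷ φ[w(∃x φ)] (by (EWI)) gives φ[t], Γ ▷ Δ.
module Submission where

open import Defs
open import Relation.Binary.PropositionalEquality using (_≡_; refl)
open import Data.List using (List; []; _∷_; _++_)
open import Data.List.Membership.Propositional using (_∈_)
open import Data.List.Membership.Propositional.Properties using (∈-++⁻; ∈-++⁺ˡ; ∈-++⁺ʳ)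
open import Data.Product using (_,_)
open import Data.Sum using (inj₁; inj₂)

module ElimDerivable (L : Signature) where
  open Henkin L

  ≋-refl : (xs : List Formula) → xs ≋ xs
  ≋-refl xs φ = (λ p → p) , (λ p → p)

  ++-comm-≋ : (xs ys : List Formula) → (xs ++ ys) ≋ (ys ++ xs)
  ++-comm-≋ xs ys φ = ++-swap xs ys , ++-swap ys xs
    where
    ++-swap : ∀ as bs → φ ∈ as ++ bs → φ ∈ bs ++ as
    ++-swap as bs φ∈ with ∈-++⁻ as φ∈
    ... | inj₁ φ∈as = ∈-++⁺ʳ bs φ∈as
    ... | inj₂ φ∈bs = ∈-++⁺ˡ φ∈bs

  module _ {X : Sequent → Set} where
    exchangeˡ : ∀ {φ ψ Δ} → X ⊢HC (φ ∷ ψ ∷ [] , Δ) → X ⊢HC (ψ ∷ φ ∷ [] , Δ)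
    exchangeˡ {φ} {ψ} {Δ} = setEq (++-comm-≋ (φ ∷ []) (ψ ∷ [])) (≋-refl Δ)

    exchangeʳ : ∀ {φ ψ Γ} → X ⊢HC (Γ , φ ∷ ψ ∷ []) → X ⊢HC (Γ , ψ ∷ φ ∷ [])
    exchangeʳ {φ} {ψ} {Γ} = setEq (≋-refl Γ) (++-comm-≋ (φ ∷ []) (ψ ∷ []))

    cutʳ : ∀ {φ Γ Δ Π Σ} → X ⊢HC (Γ , φ ∷ Δ) → X ⊢HC (φ ∷ Π , Σ) →
           X ⊢HC (Π ++ Γ , Σ ++ Δ)
    cutʳ {Γ = Γ} {Δ} {Π} {Σ} d e = setEq (++-comm-≋ Γ Π) (++-comm-≋ Δ Σ) (CUT d e)

  elim-derivable : (P C : Sequent) → Elim P C → (λ S → S ≡ P) ⊢HC C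
  elim-derivable P C ∧L-e    = CUT (∧R (exchangeˡ (WL ID)) (WL ID)) (hyp refl)
  elim-derivable P C ∧R-e₁   = cutʳ (hyp refl) (∧L (exchangeˡ (WL ID)))
  elim-derivable P C ∧R-e₂   = cutʳ (hyp refl) (∧L (WL ID))
  elim-derivable P C ∨L-e₁   = CUT (∨R (exchangeʳ (WR ID))) (hyp refl)
  elim-derivable P C ∨L-e₂   = CUT (∨R (WR ID)) (hyp refl)
  elim-derivable P C ∨R-e    = cutʳ (hyp refl) (∨L (exchangeʳ (WR ID)) (WR ID))
  elim-derivable P C ¬R-e    = cutʳ (hyp refl) (¬L ID)
  elim-derivable P C ¬L-e    = CUT (¬R ID) (hyp refl)
  elim-derivable P C ∀LW-e   = CUT (∀RW ID) (hyp refl)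
  elim-derivable P C ∀RW-e   = cutʳ (hyp refl) (∀LW ID)
  elim-derivable P C ∃LW-e   = CUT (∃RW ID) (hyp refl)
  elim-derivable P C ∃RW-e   = cutʳ (hyp refl) (∃LW ID)
  elim-derivable P C (EWE t) = CUT (EWI t ID) (hyp refl)
  elim-derivable P C (UWE t) = cutʳ (hyp refl) (UWI t ID)

mainTheorem8 : (L : Signature) (P C : Henkin.Sequent L) →
    Henkin.Elim L P C → Henkin._⊢HC_ L (λ S → S ≡ P) C
mainTheorem8 L = ElimDerivable.elim-derivable L
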